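{- Let $\ell_1,\dots,\ell_q$ be distinct primes, $\mathfrak{m}=\prod_{i=1}^q\ell_i$, and for each $i$ let $t_i\ge1$ be an integer and $\mathfrak{m}_i=\prod_{j\ne i}\ell_j$. If $G$ is a closed subgroup of $\mathrm{GL}_2(\widehat{\mathbb{Z}})$ such that $G_{\mathfrak{m}_i\cdot\ell_i^\infty}=\pi^{ -1}(G_{\mathfrak{m}_i\ell_i^{t_i}})$ for each $i$, then $G_{\mathfrak{m}^\infty}=\pi^{ -1}(G_M)$ where $M=\prod_{i=1}^q\ell_i^{t_i}$.
   Context: For a positive integer $N$, $\mathbb{Z}_N=\prod_{\ell\mid N}\mathbb{Z}_\ell$. For $G\le\mathrm{GL}_2(\widehat{\mathbb{Z}})$: $G_N$ is the image of $G$ in $\mathrm{GL}_2(\mathbb{Z}/N\mathbb{Z})$, $G_{N^\infty}$ its image in $\mathrm{GL}_2(\mathbb{Z}_N)$, and for $m$ coprime to $n$, $G_{n\cdot m^\infty}$ its image in $\mathrm{GL}_2(\mathbb{Z}/n\mathbb{Z})\times\mathrm{GL}_2(\mathbb{Z}_m)$. $\pi$ denotes the relevant natural reduction map, and $\pi^{ -1}$ the full preimage under it. -}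

module Defs where

open import Data.Nat as ℕ using (ℕ; zero; suc; pred; _^_)
open import Data.Integer as ℤ using (ℤ; +_)
open import Data.Integer.Divisibility using () renaming (_∣_ to _∣ℤ_)
open import Data.Fin using (Fin; zero; suc; _≟_)
open import Data.Product using (Σ; ∃; _×_; _,_)
open import Relation.Nullary using (yes; no; Dec)
open import Data.Nat.Divisibility using (_∣_)

Congr : ℕ → ℤ → ℤ → Set
Congr N a b = (+ N) ∣ℤ (a ℤ.- b)

-- Profinite integers Ẑ = lim← ℤ/Nℤ, as compatible systems of residues:
-- 'res n' is a representative of the residue modulo (suc n).
record Ẑ : Set where
  field
    res    : ℕ → ℤ
    compat : ∀ m n → suc m ∣ suc n → Congr (suc m) (res n) (res m)
open Ẑ public

-- Reduction modulo N (N ≥ 1): representative of the image in ℤ/Nℤ.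
_mod_ : Ẑ → ℕ → ℤ
x mod N = res x (pred N)

record GL2Ẑ : Set where
  field
    a b c d : Ẑ
    detUnit : ∀ n → ∃ λ (u : ℤ) →
      Congr (suc n) ((res a n ℤ.* res d n ℤ.- res b n ℤ.* res c n) ℤ.* u) (+ 1)
open GL2Ẑ public

-- g and h have the same image in GL₂(ℤ/Nℤ)   (used only for N ≥ 1)
RedEq : ℕ → GL2Ẑ → GL2Ẑ → Set
RedEq N g h = Congr N (a g mod N) (a h mod N) × Congr N (b g mod N) (b h mod N)
            × Congr N (c g mod N) (c h mod N) × Congr N (d g mod N) (d h mod N)

IsProd : GL2Ẑ → GL2Ẑ → GL2Ẑ → Set
IsProd g h k = ∀ n →
    Congr (suc n) (res (a k) n) (res (a g) n ℤ.* res (a h) n ℤ.+ res (b g) n ℤ.* res (c h) n)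
  × Congr (suc n) (res (b k) n) (res (a g) n ℤ.* res (b h) n ℤ.+ res (b g) n ℤ.* res (d h) n)
  × Congr (suc n) (res (c k) n) (res (c g) n ℤ.* res (a h) n ℤ.+ res (d g) n ℤ.* res (c h) n)
  × Congr (suc n) (res (d k) n) (res (c g) n ℤ.* res (b h) n ℤ.+ res (d g) n ℤ.* res (d h) n)

IsId : GL2Ẑ → Set
IsId e = ∀ n → Congr (suc n) (res (a e) n) (+ 1) × Congr (suc n) (res (b e) n) (+ 0)
             × Congr (suc n) (res (c e) n) (+ 0) × Congr (suc n) (res (d e) n) (+ 1)

ProdIsId : GL2Ẑ → GL2Ẑ → Set
ProdIsId g h = ∀ n →
    Congr (suc n) (res (a g) n ℤ.* res (a h) n ℤ.+ res (b g) n ℤ.* res (c h) n) (+ 1)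
  × Congr (suc n) (res (a g) n ℤ.* res (b h) n ℤ.+ res (b g) n ℤ.* res (d h) n) (+ 0)
  × Congr (suc n) (res (c g) n ℤ.* res (a h) n ℤ.+ res (d g) n ℤ.* res (c h) n) (+ 0)
  × Congr (suc n) (res (c g) n ℤ.* res (b h) n ℤ.+ res (d g) n ℤ.* res (d h) n) (+ 1)

-- Closedness: g ∈ G whenever every basic neighbourhood g·ker(GL₂(Ẑ)→GL₂(ℤ/Nℤ))
-- meets G.  (This also makes G respect equality in Ẑ.)
record IsClosedSubgroup (G : GL2Ẑ → Set) : Set where
  field
    hasId  : ∃ λ e → G e × IsId e
    mulCl  : ∀ g h → G g → G h → ∃ λ k → G k × IsProd g h k
    invCl  : ∀ g → G g → ∃ λ k → G k × ProdIsId k g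
    closed : ∀ g → (∀ n → ∃ λ h → G h × RedEq (suc n) h g) → G g

-- g lies in the full preimage in GL₂(Ẑ) of G_N  (N ≥ 1)
InImageMod : (GL2Ẑ → Set) → ℕ → GL2Ẑ → Set
InImageMod G N g = ∃ λ h → G h × RedEq N h g

-- g lies in the full preimage in GL₂(Ẑ) of G_{n·m^∞} ⊆ GL₂(ℤ/n) × GL₂(ℤ_m)
-- (the kernel of GL₂(Ẑ) → GL₂(ℤ/n) × GL₂(ℤ_m) is ⋂_k ker(mod n·m^k))
InImageAdic : (GL2Ẑ → Set) → ℕ → ℕ → GL2Ẑ → Set
InImageAdic G n m g = ∃ λ h → G h × (∀ k → RedEq (n ℕ.* m ^ k) h g)

prodFin : ∀ {q} → (Fin q → ℕ) → ℕ
prodFin {zero}  f = 1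
prodFin {suc q} f = f zero ℕ.* prodFin (λ i → f (suc i))

prodExcept : ∀ {q} → Fin q → (Fin q → ℕ) → ℕ
prodExcept i f = prodFin (λ j → skip (j ≟ i) (f j))
  where
  skip : ∀ {P : Set} → Dec P → ℕ → ℕ
  skip (yes _) _ = 1
  skip (no _)  x = x

{-# OPTIONS --safe #-}
module Submission where

-- One direction is immediate since M ∣ m ^ M.  Conversely, let h ∈ G with h ≡ g mod M.  Since
-- mᵢ ℓᵢ ^ tᵢ ∣ M, the hypothesis gives yᵢ ∈ G with yᵢ ≡ g modulo mᵢ ℓᵢ ^ k for every k, so
-- wᵢ = h⁻¹ yᵢ ≡ I modulo every ℓⱼ.  Choose exponents Eᵢ converging in Ẑ to the idempotent that is
-- 1 at ℓᵢ and 0 at the other ℓⱼ (essentially mᵢ ^ (n !)).  Modulo ℓᵢ ^ k the element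
-- h ∏ⱼ wⱼ ^ Eⱼ is then h wᵢ ≡ yᵢ ≡ g, because w ≡ I mod ℓ forces w ^ (ℓ ^ k) ≡ I mod ℓ ^ (k + 1);
-- by the Chinese remainder theorem it is ≡ g modulo m ^ k.  Powers of a matrix modulo N are
-- eventually periodic with preperiod and period at most N ⁴ (pigeonhole), so these elements form a
-- coherent sequence in G, whose limit lies in G because G is closed and is ≡ g modulo every m ^ k.

open import Defs
open import Data.Nat using (ℕ; _≤_; _^_; _*_)
open import Data.Nat.Primality using (Prime; euclidsLemma; prime⇒irreducible; prime⇒nonTrivial)
open import Data.Fin using (Fin; zero; suc; _≟_; toℕ; fromℕ<; combine)
import Data.Fin.Properties as Finₚ
open import Function.Definitions using (Injective)
open import Function.Bundles using (_⇔_; Equivalence; mk⇔)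
open import Relation.Binary.PropositionalEquality using (_≡_)

open import Data.Nat using (zero; suc; pred; _+_; _∸_; _<_; _!; z≤n; s≤s)
open import Data.Nat using (NonZero; ≢-nonZero; >-nonZero; nonTrivial⇒n>1; nonTrivial⇒≢1)
import Data.Nat.Properties as ℕₚ
import Data.Nat.Divisibility as ℕ∣
open ℕ∣ using (_∣_; divides)
open import Data.Integer as ℤ using (ℤ; +_)
import Data.Integer.Properties as ℤₚ
import Data.Integer.Divisibility.Signed as ℤ∣
import Data.Integer.DivMod as ℤ÷
open import Data.Integer.Tactic.RingSolver using (solve-∀)
import Data.Nat.Tactic.RingSolver as ℕSolver
open import Data.Product using (Σ; ∃; _×_; _,_; proj₁; proj₂)
open import Data.Sum using (inj₁; inj₂)
open import Data.Empty using (⊥-elim)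
open import Relation.Nullary using (¬_; Dec; yes; no)
open import Function using (_∘_)
open import Level using (0ℓ)
open import Relation.Binary.Bundles using (Setoid)
import Relation.Binary.Reasoning.Setoid as SetoidReasoning
open import Relation.Binary.PropositionalEquality using (refl; sym; trans; cong; cong₂; subst; subst₂; _≢_; module ≡-Reasoning)

-- Congruences of integers

infix 4 _≡[_]_
record _≡[_]_ (x : ℤ) (N : ℕ) (y : ℤ) : Set where
  constructor mkMod
  field congr : Congr N x y
open _≡[_]_ public

fromDivides : ∀ {N x y} → + N ℤ∣.∣ x ℤ.- y → x ≡[ N ] y
fromDivides d = mkMod (ℤ∣.∣⇒∣ᵤ d)

toDivides : ∀ {N x y} → x ≡[ N ] y → + N ℤ∣.∣ x ℤ.- y
toDivides (mkMod d) = ℤ∣.∣ᵤ⇒∣ d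

module _ {N : ℕ} where

  mod-refl : ∀ {x} → x ≡[ N ] x
  mod-refl {x} = fromDivides (subst (+ N ℤ∣.∣_) (sym (ℤₚ.+-inverseʳ x)) (ℤ∣.divides (+ 0) refl))

  mod-sym : ∀ {x y} → x ≡[ N ] y → y ≡[ N ] x
  mod-sym {x} {y} p = fromDivides (subst (+ N ℤ∣.∣_) (swap x y) (ℤ∣.∣m⇒∣-m (toDivides p)))
    where
    swap : ∀ x y → ℤ.- (x ℤ.- y) ≡ y ℤ.- x
    swap = solve-∀

  mod-trans : ∀ {x y z} → x ≡[ N ] y → y ≡[ N ] z → x ≡[ N ] z
  mod-trans {x} {y} {z} p q =
    fromDivides (subst (+ N ℤ∣.∣_) (telescope x y z) (ℤ∣.∣m∣n⇒∣m+n (toDivides p) (toDivides q)))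
    where
    telescope : ∀ x y z → (x ℤ.- y) ℤ.+ (y ℤ.- z) ≡ x ℤ.- z
    telescope = solve-∀

  mod-+-cong : ∀ {x y u v} → x ≡[ N ] y → u ≡[ N ] v → x ℤ.+ u ≡[ N ] y ℤ.+ v
  mod-+-cong {x} {y} {u} {v} p q =
    fromDivides (subst (+ N ℤ∣.∣_) (regroup x y u v) (ℤ∣.∣m∣n⇒∣m+n (toDivides p) (toDivides q)))
    where
    regroup : ∀ x y u v → (x ℤ.- y) ℤ.+ (u ℤ.- v) ≡ (x ℤ.+ u) ℤ.- (y ℤ.+ v)
    regroup = solve-∀

  mod-*-cong : ∀ {x y u v} → x ≡[ N ] y → u ≡[ N ] v → x ℤ.* u ≡[ N ] y ℤ.* v
  mod-*-cong {x} {y} {u} {v} p q = fromDivides (subst (+ N ℤ∣.∣_) (regroup x y u v)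
    (ℤ∣.∣m∣n⇒∣m+n (ℤ∣.∣m⇒∣m*n u (toDivides p)) (ℤ∣.∣n⇒∣m*n y (toDivides q))))
    where
    regroup : ∀ x y u v → (x ℤ.- y) ℤ.* u ℤ.+ y ℤ.* (u ℤ.- v) ≡ x ℤ.* u ℤ.- y ℤ.* v
    regroup = solve-∀

mod-weaken : ∀ {d N x y} → d ∣ N → x ≡[ N ] y → x ≡[ d ] y
mod-weaken {d} d∣N p = fromDivides (ℤ∣.∣-trans (ℤ∣.∣ᵤ⇒∣ {+ d} d∣N) (toDivides p))

mod-1 : ∀ {x y} → x ≡[ 1 ] y
mod-1 = mkMod (ℕ∣.1∣ _)

∣+x-+y∣≡y∸x : ∀ {x y} → x ≤ y → ℤ.∣ + x ℤ.- + y ∣ ≡ y ∸ x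
∣+x-+y∣≡y∸x {x} {y} x≤y = trans (cong ℤ.∣_∣ (ℤₚ.[+m]-[+n]≡m⊖n x y)) (ℤₚ.∣⊖∣-≤ x≤y)

mod-ℕ⇒∣∸ : ∀ {d x y} → x ≤ y → + x ≡[ d ] + y → d ∣ y ∸ x
mod-ℕ⇒∣∸ {d} x≤y (mkMod p) = subst (d ∣_) (∣+x-+y∣≡y∸x x≤y) p

∣∸⇒mod-ℕ : ∀ {d x y} → x ≤ y → d ∣ y ∸ x → + x ≡[ d ] + y
∣∸⇒mod-ℕ {d} x≤y p = mkMod (subst (d ∣_) (sym (∣+x-+y∣≡y∸x x≤y)) p)

∣⇒≡0 : ∀ {d x} → d ∣ x → + x ≡[ d ] + 0
∣⇒≡0 d∣x = mod-sym (∣∸⇒mod-ℕ z≤n d∣x)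

mod-^-≡1 : ∀ {N a} → + a ≡[ N ] + 1 → ∀ t → + (a ^ t) ≡[ N ] + 1
mod-^-≡1 a≡1 zero    = mod-refl
mod-^-≡1 {N} {a} a≡1 (suc t) = subst (λ z → z ≡[ N ] + 1) (sym (ℤₚ.pos-* a (a ^ t))) (mod-*-cong a≡1 (mod-^-≡1 a≡1 t))

mod-^-≡1-∣ : ∀ {N a s x} → + (a ^ s) ≡[ N ] + 1 → s ∣ x → + (a ^ x) ≡[ N ] + 1
mod-^-≡1-∣ {N} {a} {s} aˢ≡1 (divides t refl) =
  subst (λ e → + e ≡[ N ] + 1) (trans (ℕₚ.^-*-assoc a s t) (cong (a ^_) (ℕₚ.*-comm s t))) (mod-^-≡1 aˢ≡1 t)

-- Primes, products and factorials

infix 10 _⁴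
_⁴ : ℕ → ℕ
n ⁴ = n * (n * (n * n))

⁴-mono-≤ : ∀ {m n} → m ≤ n → m ⁴ ≤ n ⁴
⁴-mono-≤ m≤n = ℕₚ.*-mono-≤ m≤n (ℕₚ.*-mono-≤ m≤n (ℕₚ.*-mono-≤ m≤n m≤n))

n≤n⁴ : ∀ {n} → 1 ≤ n → n ≤ n ⁴
n≤n⁴ {n} 1≤n =
  subst (_≤ n ⁴) (ℕₚ.*-identityʳ n) (ℕₚ.*-monoʳ-≤ n (ℕₚ.*-mono-≤ 1≤n (ℕₚ.*-mono-≤ 1≤n 1≤n)))

prime≥2 : ∀ {p} → Prime p → 2 ≤ p
prime≥2 {p} p-prime = nonTrivial⇒n>1 p {{prime⇒nonTrivial p-prime}}

prime≥1 : ∀ {p} → Prime p → 1 ≤ p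
prime≥1 p-prime = ℕₚ.≤-trans (s≤s z≤n) (prime≥2 p-prime)

prime∤1 : ∀ {p} → Prime p → ¬ p ∣ 1
prime∤1 p-prime p∣1 = nonTrivial⇒≢1 {{prime⇒nonTrivial p-prime}} (ℕ∣.∣1⇒≡1 p∣1)

prime∣prime⇒≡ : ∀ {p r} → Prime p → Prime r → p ∣ r → p ≡ r
prime∣prime⇒≡ p-prime r-prime p∣r with prime⇒irreducible r-prime p∣r
... | inj₁ refl = ⊥-elim (prime∤1 p-prime ℕ∣.∣-refl)
... | inj₂ p≡r  = p≡r

prime∤^ : ∀ {p c} → Prime p → ¬ p ∣ c → ∀ r → ¬ p ∣ c ^ r
prime∤^ p-prime p∤c zero    = prime∤1 p-prime
prime∤^ p-prime p∤c (suc r) p∣c^[1+r] with euclidsLemma _ _ p-prime p∣c^[1+r]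
... | inj₁ p∣c   = p∤c p∣c
... | inj₂ p∣c^r = prime∤^ p-prime p∤c r p∣c^r

prime^-cancelˡ : ∀ {p c} → Prime p → ¬ p ∣ c → ∀ k y → p ^ k ∣ c * y → p ^ k ∣ y
prime^-cancelˡ p-prime p∤c zero    y _ = ℕ∣.1∣ y
prime^-cancelˡ {p} {c} p-prime p∤c (suc k) y p^[1+k]∣cy
  with euclidsLemma c y p-prime (ℕ∣.∣-trans (ℕ∣.m∣m*n (p ^ k)) p^[1+k]∣cy)
... | inj₁ p∣c = ⊥-elim (p∤c p∣c)
... | inj₂ (divides y′ refl) = subst (p * p ^ k ∣_) (ℕₚ.*-comm p y′) (ℕ∣.*-monoʳ-∣ p p^k∣y′)
  where
  rearrange : ∀ c y′ p → c * (y′ * p) ≡ p * (c * y′)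
  rearrange = ℕSolver.solve-∀
  p^k∣y′ : p ^ k ∣ y′
  p^k∣y′ = prime^-cancelˡ p-prime p∤c k y′
    (ℕ∣.*-cancelˡ-∣ p {{>-nonZero (prime≥1 p-prime)}} (subst (p * p ^ k ∣_) (rearrange c y′ p) p^[1+k]∣cy))

prime^-*-∣ : ∀ {p c x} k → Prime p → ¬ p ∣ c → p ^ k ∣ x → c ∣ x → p ^ k * c ∣ x
prime^-*-∣ {p} {c} k p-prime p∤c p^k∣x (divides e refl) =
  ℕ∣.*-monoˡ-∣ c (prime^-cancelˡ p-prime p∤c k e (subst (p ^ k ∣_) (ℕₚ.*-comm e c) p^k∣x))

*-^ : ∀ a b k → (a * b) ^ k ≡ a ^ k * b ^ k
*-^ a b zero    = refl
*-^ a b (suc k) = trans (cong (a * b *_) (*-^ a b k)) (interchange a b (a ^ k) (b ^ k))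
  where
  interchange : ∀ a b x y → a * b * (x * y) ≡ a * x * (b * y)
  interchange = ℕSolver.solve-∀

^-∣-^ : ∀ {a b} k → a ∣ b → a ^ k ∣ b ^ k
^-∣-^ zero    a∣b = ℕ∣.∣-refl
^-∣-^ (suc k) a∣b = ℕ∣.*-pres-∣ a∣b (^-∣-^ k a∣b)

^-monoʳ-∣ : ∀ a {k n} → k ≤ n → a ^ k ∣ a ^ n
^-monoʳ-∣ a {k} {n} k≤n =
  subst (a ^ k ∣_) (trans (sym (ℕₚ.^-distribˡ-+-* a k (n ∸ k))) (cong (a ^_) (ℕₚ.m+[n∸m]≡n k≤n))) (ℕ∣.m∣m*n _)

n<p^n : ∀ {p} → 2 ≤ p → ∀ n → n < p ^ n
n<p^n p≥2 zero    = s≤s z≤n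
n<p^n {p} p≥2 (suc n) = begin-strict
  suc n             <⟨ s≤s (n<p^n p≥2 n) ⟩
  1 + p ^ n         ≤⟨ ℕₚ.+-monoˡ-≤ (p ^ n) (ℕₚ.m^n>0 p {{>-nonZero (ℕₚ.≤-trans (s≤s z≤n) p≥2)}} n) ⟩
  p ^ n + p ^ n     ≡⟨ cong (λ x → p ^ n + x) (sym (ℕₚ.+-identityʳ (p ^ n))) ⟩
  2 * p ^ n         ≤⟨ ℕₚ.*-monoˡ-≤ (p ^ n) p≥2 ⟩
  p * p ^ n         ∎
  where open ℕₚ.≤-Reasoning

prodFin-cong : ∀ {q} {f g : Fin q → ℕ} → (∀ j → f j ≡ g j) → prodFin f ≡ prodFin g
prodFin-cong {zero}  f≡g = refl
prodFin-cong {suc q} f≡g = cong₂ _*_ (f≡g zero) (prodFin-cong (f≡g ∘ suc))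

prodFin-∣ : ∀ {q} {f g : Fin q → ℕ} → (∀ j → f j ∣ g j) → prodFin f ∣ prodFin g
prodFin-∣ {zero}  f∣g = ℕ∣.∣-refl
prodFin-∣ {suc q} f∣g = ℕ∣.*-pres-∣ (f∣g zero) (prodFin-∣ (f∣g ∘ suc))

∣-prodFin : ∀ {q} (f : Fin q → ℕ) j → f j ∣ prodFin f
∣-prodFin f zero    = ℕ∣.m∣m*n _
∣-prodFin f (suc j) = ℕ∣.∣n⇒∣m*n (f zero) (∣-prodFin (f ∘ suc) j)

prodFin≥1 : ∀ {q} {f : Fin q → ℕ} → (∀ j → 1 ≤ f j) → 1 ≤ prodFin f
prodFin≥1 {zero}  f≥1 = s≤s z≤n
prodFin≥1 {suc q} f≥1 = ℕₚ.*-mono-≤ (f≥1 zero) (prodFin≥1 (f≥1 ∘ suc))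

prodFin-^ : ∀ {q} (f : Fin q → ℕ) k → prodFin f ^ k ≡ prodFin (λ j → f j ^ k)
prodFin-^ {zero}  f k = ℕₚ.^-zeroˡ k
prodFin-^ {suc q} f k = trans (*-^ (f zero) _ k) (cong (f zero ^ k *_) (prodFin-^ (f ∘ suc) k))

prime∣prodFin : ∀ {q p} (f : Fin q → ℕ) → Prime p → p ∣ prodFin f → ∃ λ j → p ∣ f j
prime∣prodFin {zero}  f p-prime p∣1 = ⊥-elim (prime∤1 p-prime p∣1)
prime∣prodFin {suc q} f p-prime p∣∏ with euclidsLemma (f zero) _ p-prime p∣∏
... | inj₁ p∣f₀ = zero , p∣f₀
... | inj₂ p∣∏′ with j , p∣fⱼ ← prime∣prodFin (f ∘ suc) p-prime p∣∏′ = suc j , p∣fⱼ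

unless : ∀ {P : Set} → Dec P → ℕ → ℕ
unless (yes _) _ = 1
unless (no _)  x = x

-- Defs hides the helper that prodExcept is built from; unification recovers it here.
private
  factorsExcept : ∀ {q} (i : Fin q) (f : Fin q → ℕ) → Σ (Fin q → ℕ) λ g → prodExcept i f ≡ prodFin g
  factorsExcept i f = _ , refl

prodExcept≡ : ∀ {q} (i : Fin q) f → prodExcept i f ≡ prodFin (λ j → unless (j ≟ i) (f j))
prodExcept≡ i f = trans (proj₂ (factorsExcept i f)) (prodFin-cong pointwise)
  where
  pointwise : ∀ j → proj₁ (factorsExcept i f) j ≡ unless (j ≟ i) (f j)
  pointwise j with j ≟ i
  ... | yes _ = refl
  ... | no _  = refl

unless-suc : ∀ {q} (i j : Fin q) x → unless (suc j ≟ suc i) x ≡ unless (j ≟ i) x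
unless-suc i j x with j ≟ i
... | yes _ = refl
... | no _  = refl

unless-no : ∀ {q} {i j : Fin q} x → j ≢ i → unless (j ≟ i) x ≡ x
unless-no {i = i} {j} x j≢i with j ≟ i
... | yes j≡i = ⊥-elim (j≢i j≡i)
... | no _    = refl

unless≥1 : ∀ {P : Set} (d : Dec P) {x} → 1 ≤ x → 1 ≤ unless d x
unless≥1 (yes _) _   = ℕₚ.≤-refl
unless≥1 (no _)  1≤x = 1≤x

unless-pres : ∀ {q} (R : ℕ → ℕ → Set) → R 1 1 → ∀ {i j : Fin q} {x y}
            → R x y → R (unless (j ≟ i) x) (unless (j ≟ i) y)
unless-pres R R11 {i} {j} Rxy with j ≟ i
... | yes _ = R11
... | no _  = Rxy

prodExcept-* : ∀ {q} (i : Fin q) f → prodExcept i f * f i ≡ prodFin f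
prodExcept-* i f = trans (cong (_* f i) (prodExcept≡ i f)) (unfolded i f)
  where
  unfolded : ∀ {q} (i : Fin q) f → prodFin (λ j → unless (j ≟ i) (f j)) * f i ≡ prodFin f
  unfolded zero    f = trans (cong (_* f zero) (ℕₚ.*-identityˡ (prodFin (f ∘ suc)))) (ℕₚ.*-comm _ (f zero))
  unfolded (suc i) f = begin
    f zero * prodFin (λ j → unless (suc j ≟ suc i) (f (suc j))) * f (suc i)
      ≡⟨ cong (λ x → f zero * x * f (suc i)) (prodFin-cong λ j → unless-suc i j (f (suc j))) ⟩
    f zero * prodFin (λ j → unless (j ≟ i) (f (suc j))) * f (suc i)
      ≡⟨ ℕₚ.*-assoc (f zero) _ _ ⟩
    f zero * (prodFin (λ j → unless (j ≟ i) (f (suc j))) * f (suc i))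
      ≡⟨ cong (f zero *_) (unfolded i (f ∘ suc)) ⟩
    prodFin f ∎
    where open ≡-Reasoning

∣-prodExcept : ∀ {q} {i j : Fin q} f → j ≢ i → f j ∣ prodExcept i f
∣-prodExcept {i = i} {j} f j≢i = subst (f j ∣_) (sym (prodExcept≡ i f))
  (subst (_∣ prodFin (λ k → unless (k ≟ i) (f k))) (unless-no (f j) j≢i) (∣-prodFin (λ k → unless (k ≟ i) (f k)) j))

prodExcept-∣ : ∀ {q} (i : Fin q) {f g} → (∀ j → f j ∣ g j) → prodExcept i f ∣ prodExcept i g
prodExcept-∣ i {f} {g} f∣g = subst₂ _∣_ (sym (prodExcept≡ i f)) (sym (prodExcept≡ i g))
  (prodFin-∣ λ j → unless-pres _∣_ ℕ∣.∣-refl (f∣g j))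

prodExcept≥1 : ∀ {q} (i : Fin q) {f} → (∀ j → 1 ≤ f j) → 1 ≤ prodExcept i f
prodExcept≥1 i {f} f≥1 = subst (1 ≤_) (sym (prodExcept≡ i f))
  (prodFin≥1 λ j → unless≥1 (j ≟ i) (f≥1 j))

prodExcept-*-∣ : ∀ {q} (i : Fin q) {f g} → (∀ j → f j ∣ g j) → prodExcept i f * g i ∣ prodFin g
prodExcept-*-∣ i {f} {g} f∣g =
  subst (prodExcept i f * g i ∣_) (prodExcept-* i g) (ℕ∣.*-monoˡ-∣ (g i) (prodExcept-∣ i f∣g))

prime∤prodExcept : ∀ {q} {ℓ : Fin q → ℕ} → (∀ i → Prime (ℓ i)) → Injective _≡_ _≡_ ℓ
                 → ∀ i → ¬ ℓ i ∣ prodExcept i ℓ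
prime∤prodExcept {ℓ = ℓ} primes ℓ-injective i ℓᵢ∣
  with j , ℓᵢ∣factorⱼ ← prime∣prodFin _ (primes i) (subst (ℓ i ∣_) (prodExcept≡ i ℓ) ℓᵢ∣)
  with j ≟ i
... | yes _   = prime∤1 (primes i) ℓᵢ∣factorⱼ
... | no j≢i  = j≢i (sym (ℓ-injective (prime∣prime⇒≡ (primes i) (primes j) ℓᵢ∣factorⱼ)))

prime-powers-∣⇒prodFin-^-∣ : ∀ {q} {ℓ : Fin q → ℕ} → (∀ i → Prime (ℓ i)) → Injective _≡_ _≡_ ℓ
                            → ∀ k {z} → (∀ i → ℓ i ^ k ∣ z) → prodFin ℓ ^ k ∣ z
prime-powers-∣⇒prodFin-^-∣ {zero}  _ _ k {z} _ = subst (_∣ z) (sym (ℕₚ.^-zeroˡ k)) (ℕ∣.1∣ z)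
prime-powers-∣⇒prodFin-^-∣ {suc q} {ℓ} primes ℓ-injective k ℓ^k∣z =
  subst (_∣ _) (sym (*-^ (ℓ zero) (prodFin (ℓ ∘ suc)) k))
    (prime^-*-∣ k (primes zero) (prime∤^ (primes zero) ℓ₀∤rest k) (ℓ^k∣z zero)
      (prime-powers-∣⇒prodFin-^-∣ (primes ∘ suc) (Finₚ.suc-injective ∘ ℓ-injective) k (ℓ^k∣z ∘ suc)))
  where
  ℓ₀∤rest : ¬ ℓ zero ∣ prodFin (ℓ ∘ suc)
  ℓ₀∤rest ℓ₀∣ with j , ℓ₀∣ℓⱼ ← prime∣prodFin (ℓ ∘ suc) (primes zero) ℓ₀∣
    with () ← ℓ-injective (prime∣prime⇒≡ (primes zero) (primes (suc j)) ℓ₀∣ℓⱼ)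

DivisibleUpTo : ℕ → ℕ → Set
DivisibleUpTo K d = ∀ {s} → 1 ≤ s → s ≤ K → s ∣ d

n≤n! : ∀ n → n ≤ n !
n≤n! zero    = z≤n
n≤n! (suc n) = subst (_≤ suc n !) (ℕₚ.*-identityʳ (suc n)) (ℕₚ.*-monoʳ-≤ (suc n) (ℕₚ.1≤n! n))

!-mono-≤ : ∀ {m n} → m ≤ n → m ! ≤ n !
!-mono-≤ {m} {n} m≤n = ℕ∣.∣⇒≤ {{n !≢0}} (ℕ∣.m≤n⇒m!∣n! m≤n)
  where open ℕₚ using (_!≢0)

!-divisibleUpTo : ∀ n → DivisibleUpTo n (n !)
!-divisibleUpTo n {suc s} _ s≤n = ℕ∣.∣-trans (ℕ∣.m∣m*n (s !)) (ℕ∣.m≤n⇒m!∣n! s≤n)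

mod-crt : ∀ {q} {ℓ : Fin q → ℕ} → (∀ i → Prime (ℓ i)) → Injective _≡_ _≡_ ℓ
        → ∀ k {x y} → (∀ i → x ≡[ ℓ i ^ k ] y) → x ≡[ prodFin ℓ ^ k ] y
mod-crt primes ℓ-injective k x≡y = mkMod (prime-powers-∣⇒prodFin-^-∣ primes ℓ-injective k (congr ∘ x≡y))

-- 2 × 2 integer matrices

record Mat : Set where
  constructor mat
  field m₁₁ m₁₂ m₂₁ m₂₂ : ℤ
open Mat public

I : Mat
I = mat (+ 1) (+ 0) (+ 0) (+ 1)

infixl 7 _⊗_
_⊗_ : Mat → Mat → Mat
A ⊗ B = mat (m₁₁ A ℤ.* m₁₁ B ℤ.+ m₁₂ A ℤ.* m₂₁ B) (m₁₁ A ℤ.* m₁₂ B ℤ.+ m₁₂ A ℤ.* m₂₂ B)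
            (m₂₁ A ℤ.* m₁₁ B ℤ.+ m₂₂ A ℤ.* m₂₁ B) (m₂₁ A ℤ.* m₁₂ B ℤ.+ m₂₂ A ℤ.* m₂₂ B)

mat-≡ : ∀ {A B} → m₁₁ A ≡ m₁₁ B → m₁₂ A ≡ m₁₂ B → m₂₁ A ≡ m₂₁ B → m₂₂ A ≡ m₂₂ B → A ≡ B
mat-≡ refl refl refl refl = refl

⊗-assoc : ∀ A B C → (A ⊗ B) ⊗ C ≡ A ⊗ (B ⊗ C)
⊗-assoc (mat a b c d) (mat a′ b′ c′ d′) (mat a″ b″ c″ d″) =
  mat-≡ (left a b a′ b′ c′ d′ a″ c″) (right a b a′ b′ c′ d′ b″ d″)
        (left c d a′ b′ c′ d′ a″ c″) (right c d a′ b′ c′ d′ b″ d″)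
  where
  left : ∀ a b a′ b′ c′ d′ a″ c″ →
    (a ℤ.* a′ ℤ.+ b ℤ.* c′) ℤ.* a″ ℤ.+ (a ℤ.* b′ ℤ.+ b ℤ.* d′) ℤ.* c″
      ≡ a ℤ.* (a′ ℤ.* a″ ℤ.+ b′ ℤ.* c″) ℤ.+ b ℤ.* (c′ ℤ.* a″ ℤ.+ d′ ℤ.* c″)
  left = solve-∀
  right : ∀ a b a′ b′ c′ d′ b″ d″ →
    (a ℤ.* a′ ℤ.+ b ℤ.* c′) ℤ.* b″ ℤ.+ (a ℤ.* b′ ℤ.+ b ℤ.* d′) ℤ.* d″
      ≡ a ℤ.* (a′ ℤ.* b″ ℤ.+ b′ ℤ.* d″) ℤ.+ b ℤ.* (c′ ℤ.* b″ ℤ.+ d′ ℤ.* d″)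
  right = solve-∀

⊗-identityˡ : ∀ A → I ⊗ A ≡ A
⊗-identityˡ (mat a b c d) = mat-≡ (first a c) (first b d) (second a c) (second b d)
  where
  first : ∀ x y → ℤ.1ℤ ℤ.* x ℤ.+ ℤ.0ℤ ℤ.* y ≡ x
  first = solve-∀
  second : ∀ x y → ℤ.0ℤ ℤ.* x ℤ.+ ℤ.1ℤ ℤ.* y ≡ y
  second = solve-∀

⊗-identityʳ : ∀ A → A ⊗ I ≡ A
⊗-identityʳ (mat a b c d) = mat-≡ (first a b) (second a b) (first c d) (second c d)
  where
  first : ∀ x y → x ℤ.* ℤ.1ℤ ℤ.+ y ℤ.* ℤ.0ℤ ≡ x
  first = solve-∀
  second : ∀ x y → x ℤ.* ℤ.0ℤ ℤ.+ y ℤ.* ℤ.1ℤ ≡ y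
  second = solve-∀

infixr 8 _^ᴹ_
_^ᴹ_ : Mat → ℕ → Mat
A ^ᴹ zero  = I
A ^ᴹ suc n = A ⊗ A ^ᴹ n

^ᴹ-+ : ∀ A m n → A ^ᴹ (m + n) ≡ A ^ᴹ m ⊗ A ^ᴹ n
^ᴹ-+ A zero    n = sym (⊗-identityˡ (A ^ᴹ n))
^ᴹ-+ A (suc m) n = trans (cong (A ⊗_) (^ᴹ-+ A m n)) (sym (⊗-assoc A (A ^ᴹ m) (A ^ᴹ n)))

^ᴹ-* : ∀ A m n → A ^ᴹ (m * n) ≡ (A ^ᴹ n) ^ᴹ m
^ᴹ-* A zero    n = refl
^ᴹ-* A (suc m) n = trans (^ᴹ-+ A n (m * n)) (cong (A ^ᴹ n ⊗_) (^ᴹ-* A m n))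

I-^ᴹ : ∀ n → I ^ᴹ n ≡ I
I-^ᴹ zero    = refl
I-^ᴹ (suc n) = trans (cong (I ⊗_) (I-^ᴹ n)) (⊗-identityˡ I)

infix 4 _≋[_]_
record _≋[_]_ (A : Mat) (N : ℕ) (B : Mat) : Set where
  constructor entrywise
  field
    ≋₁₁ : m₁₁ A ≡[ N ] m₁₁ B
    ≋₁₂ : m₁₂ A ≡[ N ] m₁₂ B
    ≋₂₁ : m₂₁ A ≡[ N ] m₂₁ B
    ≋₂₂ : m₂₂ A ≡[ N ] m₂₂ B
open _≋[_]_ public

module _ {N : ℕ} where

  ≋-refl : ∀ {A} → A ≋[ N ] A
  ≋-refl = entrywise mod-refl mod-refl mod-refl mod-refl

  ≋-reflexive : ∀ {A B} → A ≡ B → A ≋[ N ] B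
  ≋-reflexive refl = ≋-refl

  ≋-sym : ∀ {A B} → A ≋[ N ] B → B ≋[ N ] A
  ≋-sym (entrywise p q r s) = entrywise (mod-sym p) (mod-sym q) (mod-sym r) (mod-sym s)

  ≋-trans : ∀ {A B C} → A ≋[ N ] B → B ≋[ N ] C → A ≋[ N ] C
  ≋-trans (entrywise p q r s) (entrywise p′ q′ r′ s′) =
    entrywise (mod-trans p p′) (mod-trans q q′) (mod-trans r r′) (mod-trans s s′)

  ⊗-cong : ∀ {A B A′ B′} → A ≋[ N ] A′ → B ≋[ N ] B′ → A ⊗ B ≋[ N ] A′ ⊗ B′
  ⊗-cong (entrywise p q r s) (entrywise p′ q′ r′ s′) =
    entrywise (mod-+-cong (mod-*-cong p p′) (mod-*-cong q r′)) (mod-+-cong (mod-*-cong p q′) (mod-*-cong q s′))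
              (mod-+-cong (mod-*-cong r p′) (mod-*-cong s r′)) (mod-+-cong (mod-*-cong r q′) (mod-*-cong s s′))

  ⊗-congˡ : ∀ {A B B′} → B ≋[ N ] B′ → A ⊗ B ≋[ N ] A ⊗ B′
  ⊗-congˡ {A} = ⊗-cong {A = A} {A′ = A} ≋-refl

  ^ᴹ-cong : ∀ {A B} n → A ≋[ N ] B → A ^ᴹ n ≋[ N ] B ^ᴹ n
  ^ᴹ-cong zero    p = ≋-refl
  ^ᴹ-cong (suc n) p = ⊗-cong p (^ᴹ-cong n p)

  ^ᴹ-≋I : ∀ {A} n → A ≋[ N ] I → A ^ᴹ n ≋[ N ] I
  ^ᴹ-≋I n p = ≋-trans (^ᴹ-cong n p) (≋-reflexive (I-^ᴹ n))

≋-weaken : ∀ {d N A B} → d ∣ N → A ≋[ N ] B → A ≋[ d ] B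
≋-weaken d∣N (entrywise p q r s) = 
  entrywise (mod-weaken d∣N p) (mod-weaken d∣N q) (mod-weaken d∣N r) (mod-weaken d∣N s)

≋-1 : ∀ {A B} → A ≋[ 1 ] B
≋-1 = entrywise mod-1 mod-1 mod-1 mod-1

≋-setoid : ℕ → Setoid 0ℓ 0ℓ
≋-setoid N = record
  { Carrier = Mat
  ; _≈_ = λ A B → A ≋[ N ] B
  ; isEquivalence = record { refl = ≋-refl ; sym = ≋-sym ; trans = ≋-trans }
  }

module ≋-Reasoning (N : ℕ) = SetoidReasoning (≋-setoid N)

∏ᴹ : ∀ {q} → (Fin q → Mat) → Mat
∏ᴹ {zero}  A = I
∏ᴹ {suc q} A = A zero ⊗ ∏ᴹ (λ i → A (suc i))

module _ {N : ℕ} where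

  ∏ᴹ-cong : ∀ {q} {A B : Fin q → Mat} → (∀ i → A i ≋[ N ] B i) → ∏ᴹ A ≋[ N ] ∏ᴹ B
  ∏ᴹ-cong {zero}  A≋B = ≋-refl
  ∏ᴹ-cong {suc q} A≋B = ⊗-cong (A≋B zero) (∏ᴹ-cong (λ i → A≋B (suc i)))

  ∏ᴹ-≋I : ∀ {q} {A : Fin q → Mat} → (∀ i → A i ≋[ N ] I) → ∏ᴹ A ≋[ N ] I
  ∏ᴹ-≋I {zero}  A≋I = ≋-refl
  ∏ᴹ-≋I {suc q} A≋I = ≋-trans (⊗-cong (A≋I zero) (∏ᴹ-≋I (λ i → A≋I (suc i)))) (≋-reflexive (⊗-identityˡ I))

  ∏ᴹ-single : ∀ {q} (A : Fin q → Mat) i → (∀ j → j ≢ i → A j ≋[ N ] I) → ∏ᴹ A ≋[ N ] A i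
  ∏ᴹ-single A zero others =
    ≋-trans (⊗-congˡ {A = A zero} (∏ᴹ-≋I (λ j → others (suc j) λ ()))) (≋-reflexive (⊗-identityʳ (A zero)))
  ∏ᴹ-single A (suc i) others =
    ≋-trans (⊗-cong (others zero λ ())
                    (∏ᴹ-single (λ j → A (suc j)) i λ j j≢i → others (suc j) (j≢i ∘ Finₚ.suc-injective)))
            (≋-reflexive (⊗-identityˡ (A (suc i))))

≋-crt : ∀ {q} {ℓ : Fin q → ℕ} → (∀ i → Prime (ℓ i)) → Injective _≡_ _≡_ ℓ
      → ∀ k {A B} → (∀ i → A ≋[ ℓ i ^ k ] B) → A ≋[ prodFin ℓ ^ k ] B
≋-crt primes ℓ-injective k A≋B =
  entrywise (crt (≋₁₁ ∘ A≋B)) (crt (≋₁₂ ∘ A≋B)) (crt (≋₂₁ ∘ A≋B)) (crt (≋₂₂ ∘ A≋B))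
  where crt = mod-crt primes ℓ-injective k

-- Eventual periodicity of powers modulo N

residue : (N : ℕ) → ℤ → Fin (suc N)
residue N x = fromℕ< (ℤ÷.n%ℕd<d x (suc N))

mod-%ℕ : ∀ N x → x ≡[ suc N ] + (x ℤ÷.%ℕ suc N)
mod-%ℕ N x = fromDivides (ℤ∣.divides (x ℤ÷./ℕ suc N) (begin
  x ℤ.- + r                                   ≡⟨ cong (ℤ._- + r) (ℤ÷.a≡a%ℕn+[a/ℕn]*n x (suc N)) ⟩
  + r ℤ.+ (x ℤ÷./ℕ suc N) ℤ.* + suc N ℤ.- + r ≡⟨ cancel (+ r) (x ℤ÷./ℕ suc N ℤ.* + suc N) ⟩
  (x ℤ÷./ℕ suc N) ℤ.* + suc N                 ∎))
  where
  open ≡-Reasoning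
  r = x ℤ÷.%ℕ suc N
  cancel : ∀ r u → r ℤ.+ u ℤ.- r ≡ u
  cancel = solve-∀

residue-injective : ∀ N x y → residue N x ≡ residue N y → x ≡[ suc N ] y
residue-injective N x y eq =
  mod-trans (mod-%ℕ N x) (subst (λ r → + r ≡[ suc N ] y) (sym same-remainder) (mod-sym (mod-%ℕ N y)))
  where
  same-remainder : x ℤ÷.%ℕ suc N ≡ y ℤ÷.%ℕ suc N
  same-remainder = trans (sym (Finₚ.toℕ-fromℕ< _)) (trans (cong toℕ eq) (Finₚ.toℕ-fromℕ< _))

encode : (N : ℕ) → Mat → Fin (suc N ⁴)
encode N A = combine (residue N (m₁₁ A)) (combine (residue N (m₁₂ A)) (combine (residue N (m₂₁ A)) (residue N (m₂₂ A))))

encode-injective : ∀ N A B → encode N A ≡ encode N B → A ≋[ suc N ] B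
encode-injective N A B eq
  with e₁₁ , eq′ ← Finₚ.combine-injective _ _ _ _ eq
  with e₁₂ , eq″ ← Finₚ.combine-injective _ _ _ _ eq′
  with e₂₁ , e₂₂ ← Finₚ.combine-injective _ _ _ _ eq″
  = entrywise (residue-injective N _ _ e₁₁) (residue-injective N _ _ e₁₂)
              (residue-injective N _ _ e₂₁) (residue-injective N _ _ e₂₂)

record Period (N : ℕ) (A : Mat) : Set where
  field
    preperiod period : ℕ
    period≥1 : 1 ≤ period
    bounded  : preperiod + period ≤ N ⁴
    periodic : A ^ᴹ preperiod ≋[ N ] A ^ᴹ (preperiod + period)

opaque
  period-by-pigeonhole : ∀ N A → Period (suc N) A
  period-by-pigeonhole N A
    with i , j , i<j , eq ← Finₚ.pigeonhole (ℕₚ.n<1+n (suc N ⁴)) (λ k → encode N (A ^ᴹ toℕ k))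
    = record
    { preperiod = toℕ i
    ; period    = toℕ j ∸ toℕ i
    ; period≥1  = ℕₚ.m<n⇒0<n∸m i<j
    ; bounded   = subst (_≤ suc N ⁴) (sym i+[j∸i]≡j) (ℕₚ.≤-pred (Finₚ.toℕ<n j))
    ; periodic  = subst (λ e → A ^ᴹ toℕ i ≋[ suc N ] A ^ᴹ e) (sym i+[j∸i]≡j) (encode-injective N _ _ eq)
    }
    where
    i+[j∸i]≡j : toℕ i + (toℕ j ∸ toℕ i) ≡ toℕ j
    i+[j∸i]≡j = ℕₚ.m+[n∸m]≡n (ℕₚ.<⇒≤ i<j)

module _ {N : ℕ} {A : Mat} (P : Period N A) where
  open Period P

  ^ᴹ-shift : ∀ {w} → preperiod ≤ w → A ^ᴹ (w + period) ≋[ N ] A ^ᴹ w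
  ^ᴹ-shift {w} r≤w = begin
    A ^ᴹ (w + period)                              ≡⟨ cong (λ e → A ^ᴹ (e + period)) (sym w∸r+r≡w) ⟩
    A ^ᴹ (w ∸ preperiod + preperiod + period)      ≡⟨ cong (A ^ᴹ_) (ℕₚ.+-assoc (w ∸ preperiod) preperiod period) ⟩
    A ^ᴹ (w ∸ preperiod + (preperiod + period))    ≡⟨ ^ᴹ-+ A (w ∸ preperiod) (preperiod + period) ⟩
    A ^ᴹ (w ∸ preperiod) ⊗ A ^ᴹ (preperiod + period) ≈⟨ ⊗-congˡ {A = A ^ᴹ (w ∸ preperiod)} (≋-sym periodic) ⟩
    A ^ᴹ (w ∸ preperiod) ⊗ A ^ᴹ preperiod          ≡⟨ sym (^ᴹ-+ A (w ∸ preperiod) preperiod) ⟩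
    A ^ᴹ (w ∸ preperiod + preperiod)               ≡⟨ cong (A ^ᴹ_) w∸r+r≡w ⟩
    A ^ᴹ w                                         ∎
    where
    open ≋-Reasoning N
    w∸r+r≡w : w ∸ preperiod + preperiod ≡ w
    w∸r+r≡w = ℕₚ.m∸n+n≡m r≤w

  ^ᴹ-shift-* : ∀ k {w} → preperiod ≤ w → A ^ᴹ (w + k * period) ≋[ N ] A ^ᴹ w
  ^ᴹ-shift-* zero    {w} r≤w = ≋-reflexive (cong (A ^ᴹ_) (ℕₚ.+-identityʳ w))
  ^ᴹ-shift-* (suc k) {w} r≤w = begin
    A ^ᴹ (w + (period + k * period)) ≡⟨ cong (A ^ᴹ_) (rearrange w k period) ⟩
    A ^ᴹ (w + k * period + period)   ≈⟨ ^ᴹ-shift (ℕₚ.≤-trans r≤w (ℕₚ.m≤m+n w (k * period))) ⟩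
    A ^ᴹ (w + k * period)            ≈⟨ ^ᴹ-shift-* k r≤w ⟩
    A ^ᴹ w                           ∎
    where
    open ≋-Reasoning N
    rearrange : ∀ w k s → w + (s + k * s) ≡ w + k * s + s
    rearrange = ℕSolver.solve-∀

  ^ᴹ-periodic-≤ : ∀ {x y} → preperiod ≤ x → x ≤ y → period ∣ y ∸ x → A ^ᴹ x ≋[ N ] A ^ᴹ y
  ^ᴹ-periodic-≤ {x} {y} r≤x x≤y (divides k y∸x≡k*s) = ≋-sym (begin
    A ^ᴹ y                ≡⟨ cong (A ^ᴹ_) (sym (ℕₚ.m+[n∸m]≡n x≤y)) ⟩
    A ^ᴹ (x + (y ∸ x))    ≡⟨ cong (λ e → A ^ᴹ (x + e)) y∸x≡k*s ⟩
    A ^ᴹ (x + k * period) ≈⟨ ^ᴹ-shift-* k r≤x ⟩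
    A ^ᴹ x                ∎)
    where open ≋-Reasoning N

  ^ᴹ-periodic : ∀ {x y} → preperiod ≤ x → preperiod ≤ y → + x ≡[ period ] + y → A ^ᴹ x ≋[ N ] A ^ᴹ y
  ^ᴹ-periodic {x} {y} r≤x r≤y x≡y with ℕₚ.≤-total x y
  ... | inj₁ x≤y = ^ᴹ-periodic-≤ r≤x x≤y (mod-ℕ⇒∣∸ x≤y x≡y)
  ... | inj₂ y≤x = ≋-sym (^ᴹ-periodic-≤ r≤y y≤x (mod-ℕ⇒∣∸ y≤x (mod-sym x≡y)))

^ᴹ-stable : ∀ {N d x y} A → suc N ⁴ ≤ x → suc N ⁴ ≤ y → DivisibleUpTo (suc N ⁴) d
          → + x ≡[ d ] + y → A ^ᴹ x ≋[ suc N ] A ^ᴹ y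
^ᴹ-stable {N} A K≤x K≤y d-divisible x≡y =
  ^ᴹ-periodic P (ℕₚ.≤-trans r≤K K≤x) (ℕₚ.≤-trans r≤K K≤y) (mod-weaken (d-divisible period≥1 s≤K) x≡y)
  where
  P = period-by-pigeonhole N A
  open Period P
  r≤K : preperiod ≤ suc N ⁴
  r≤K = ℕₚ.≤-trans (ℕₚ.m≤m+n preperiod period) bounded
  s≤K : period ≤ suc N ⁴
  s≤K = ℕₚ.≤-trans (ℕₚ.m≤n+m period preperiod) bounded

-- Lifting the exponent

I+_·_ : ℤ → Mat → Mat
I+ u · X = mat (m₁₁ I ℤ.+ u ℤ.* m₁₁ X) (m₁₂ I ℤ.+ u ℤ.* m₁₂ X)
                (m₂₁ I ℤ.+ u ℤ.* m₂₁ X) (m₂₂ I ℤ.+ u ℤ.* m₂₂ X)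

≋I⇒≡I+ : ∀ {D A} → A ≋[ D ] I → Σ Mat λ X → A ≡ I+ + D · X
≋I⇒≡I+ {D} (entrywise p q r s)
  with ℤ∣.divides w₁₁ e₁₁ ← toDivides p | ℤ∣.divides w₁₂ e₁₂ ← toDivides q
     | ℤ∣.divides w₂₁ e₂₁ ← toDivides r | ℤ∣.divides w₂₂ e₂₂ ← toDivides s
  = mat w₁₁ w₁₂ w₂₁ w₂₂ , mat-≡ (entry (+ 1) e₁₁) (entry (+ 0) e₁₂) (entry (+ 0) e₂₁) (entry (+ 1) e₂₂)
  where
  entry : ∀ {a} e {w} → a ℤ.- e ≡ w ℤ.* + D → a ≡ e ℤ.+ + D ℤ.* w
  entry {a} e {w} eq = trans (shift a e) (cong (λ z → e ℤ.+ z) (trans eq (ℤₚ.*-comm w (+ D))))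
    where
    shift : ∀ a e → a ≡ e ℤ.+ (a ℤ.- e)
    shift = solve-∀

I+-≋I : ∀ {N u} X → + N ℤ∣.∣ u → I+ u · X ≋[ N ] I
I+-≋I {N} {u} X N∣u =
  entrywise (drop (m₁₁ I) (m₁₁ X)) (drop (m₁₂ I) (m₁₂ X)) (drop (m₂₁ I) (m₂₁ X)) (drop (m₂₂ I) (m₂₂ X))
  where
  drop : ∀ e x → e ℤ.+ u ℤ.* x ≡[ N ] e
  drop e x = fromDivides (subst (+ N ℤ∣.∣_) (sym (cancel e u x)) (ℤ∣.∣m⇒∣m*n x N∣u))
    where
    cancel : ∀ e u x → e ℤ.+ u ℤ.* x ℤ.- e ≡ u ℤ.* x
    cancel = solve-∀

I+0·≡I : ∀ X → I+ ℤ.0ℤ · X ≡ I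
I+0·≡I X =
  mat-≡ (unit (m₁₁ I) (m₁₁ X)) (unit (m₁₂ I) (m₁₂ X)) (unit (m₂₁ I) (m₂₁ X)) (unit (m₂₂ I) (m₂₂ X))
  where
  unit : ∀ e x → e ℤ.+ ℤ.0ℤ ℤ.* x ≡ e
  unit = solve-∀

mod-by-square : ∀ {D z w} k → z ≡ w ℤ.+ (+ D ℤ.* + D) ℤ.* k → z ≡[ D * D ] w
mod-by-square {D} {z} {w} k z≡w+D²k = fromDivides (ℤ∣.divides k (begin
  z ℤ.- w                          ≡⟨ cong (ℤ._- w) z≡w+D²k ⟩
  w ℤ.+ (+ D ℤ.* + D) ℤ.* k ℤ.- w  ≡⟨ cancel w (+ D ℤ.* + D) k ⟩
  k ℤ.* (+ D ℤ.* + D)              ≡⟨ cong (k ℤ.*_) (sym (ℤₚ.pos-* D D)) ⟩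
  k ℤ.* + (D * D)                  ∎))
  where
  open ≡-Reasoning
  cancel : ∀ w s k → w ℤ.+ s ℤ.* k ℤ.- w ≡ k ℤ.* s
  cancel = solve-∀

-- (I + D X) (I + n D X) = I + (n + 1) D X + n D² X²
I+·-⊗ : ∀ D n X → I+ + D · X ⊗ I+ (+ n ℤ.* + D) · X ≋[ D * D ] I+ (+ suc n ℤ.* + D) · X
I+·-⊗ D n (mat x₁₁ x₁₂ x₂₁ x₂₂) = entrywise
  (mod-by-square {D} _ (entry₁₁ (+ D) (+ n) x₁₁ x₁₂ x₂₁))
  (mod-by-square {D} _ (entry₁₂ (+ D) (+ n) x₁₁ x₁₂ x₂₂))
  (mod-by-square {D} _ (entry₂₁ (+ D) (+ n) x₁₁ x₂₁ x₂₂))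
  (mod-by-square {D} _ (entry₂₂ (+ D) (+ n) x₁₂ x₂₁ x₂₂))
  where
  entry₁₁ : ∀ d n a b c →
    (+ 1 ℤ.+ d ℤ.* a) ℤ.* (+ 1 ℤ.+ n ℤ.* d ℤ.* a) ℤ.+ (+ 0 ℤ.+ d ℤ.* b) ℤ.* (+ 0 ℤ.+ n ℤ.* d ℤ.* c)
      ≡ + 1 ℤ.+ (+ 1 ℤ.+ n) ℤ.* d ℤ.* a ℤ.+ (d ℤ.* d) ℤ.* (n ℤ.* (a ℤ.* a ℤ.+ b ℤ.* c))
  entry₁₁ = solve-∀
  entry₁₂ : ∀ d n a b e →
    (+ 1 ℤ.+ d ℤ.* a) ℤ.* (+ 0 ℤ.+ n ℤ.* d ℤ.* b) ℤ.+ (+ 0 ℤ.+ d ℤ.* b) ℤ.* (+ 1 ℤ.+ n ℤ.* d ℤ.* e)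
      ≡ + 0 ℤ.+ (+ 1 ℤ.+ n) ℤ.* d ℤ.* b ℤ.+ (d ℤ.* d) ℤ.* (n ℤ.* (a ℤ.* b ℤ.+ b ℤ.* e))
  entry₁₂ = solve-∀
  entry₂₁ : ∀ d n a c e →
    (+ 0 ℤ.+ d ℤ.* c) ℤ.* (+ 1 ℤ.+ n ℤ.* d ℤ.* a) ℤ.+ (+ 1 ℤ.+ d ℤ.* e) ℤ.* (+ 0 ℤ.+ n ℤ.* d ℤ.* c)
      ≡ + 0 ℤ.+ (+ 1 ℤ.+ n) ℤ.* d ℤ.* c ℤ.+ (d ℤ.* d) ℤ.* (n ℤ.* (c ℤ.* a ℤ.+ e ℤ.* c))
  entry₂₁ = solve-∀
  entry₂₂ : ∀ d n b c e →
    (+ 0 ℤ.+ d ℤ.* c) ℤ.* (+ 0 ℤ.+ n ℤ.* d ℤ.* b) ℤ.+ (+ 1 ℤ.+ d ℤ.* e) ℤ.* (+ 1 ℤ.+ n ℤ.* d ℤ.* e)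
      ≡ + 1 ℤ.+ (+ 1 ℤ.+ n) ℤ.* d ℤ.* e ℤ.+ (d ℤ.* d) ℤ.* (n ℤ.* (c ℤ.* b ℤ.+ e ℤ.* e))
  entry₂₂ = solve-∀

^ᴹ-≋I+· : ∀ {D A X} → A ≡ I+ + D · X → ∀ n → A ^ᴹ n ≋[ D * D ] I+ (+ n ℤ.* + D) · X
^ᴹ-≋I+· {X = X} A≡ zero    = ≋-sym (≋-reflexive (I+0·≡I X))
^ᴹ-≋I+· {D} {A} {X} A≡ (suc n) = begin
  A ⊗ A ^ᴹ n                            ≈⟨ ⊗-cong (≋-reflexive A≡) (^ᴹ-≋I+· A≡ n) ⟩
  I+ + D · X ⊗ I+ (+ n ℤ.* + D) · X     ≈⟨ I+·-⊗ D n X ⟩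
  I+ (+ suc n ℤ.* + D) · X              ∎
  where open ≋-Reasoning (D * D)

^ᴹ-lift : ∀ {D A} p → p ∣ D → A ≋[ D ] I → A ^ᴹ p ≋[ D * p ] I
^ᴹ-lift {D} {A} p p∣D A≋I with X , A≡ ← ≋I⇒≡I+ A≋I =
  ≋-trans (≋-weaken (ℕ∣.*-monoʳ-∣ D p∣D) (^ᴹ-≋I+· A≡ p)) (I+-≋I X (ℤ∣.∣-reflexive pD≡Dp))
  where
  pD≡Dp : + (D * p) ≡ + p ℤ.* + D
  pD≡Dp = trans (cong +_ (ℕₚ.*-comm D p)) (ℤₚ.pos-* p D)

^ᴹ-lift-^ : ∀ {A} p k → A ≋[ p ] I → A ^ᴹ (p ^ k) ≋[ p ^ suc k ] I
^ᴹ-lift-^ {A} p zero    A≋I =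
  ≋-trans (≋-reflexive (⊗-identityʳ A)) (subst (λ N → A ≋[ N ] I) (sym (ℕₚ.*-identityʳ p)) A≋I)
^ᴹ-lift-^ {A} p (suc k) A≋I = subst (λ N → A ^ᴹ (p * p ^ k) ≋[ N ] I) (ℕₚ.*-comm (p ^ suc k) p) (begin
  A ^ᴹ (p * p ^ k)  ≡⟨ ^ᴹ-* A p (p ^ k) ⟩
  (A ^ᴹ p ^ k) ^ᴹ p ≈⟨ ^ᴹ-lift p (ℕ∣.m∣m*n (p ^ k)) (^ᴹ-lift-^ p k A≋I) ⟩
  I                 ∎)
  where open ≋-Reasoning (p ^ suc k * p)

^ᴹ-≋I-∣ : ∀ {A p k x} → A ≋[ p ] I → p ^ k ∣ x → A ^ᴹ x ≋[ p ^ suc k ] I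
^ᴹ-≋I-∣ {A} {p} {k} A≋I (divides c refl) =
  ≋-trans (≋-reflexive (^ᴹ-* A c (p ^ k))) (^ᴹ-≋I c (^ᴹ-lift-^ p k A≋I))

^ᴹ-≡1 : ∀ {A p k e} → A ≋[ p ] I → 1 ≤ e → + e ≡[ p ^ k ] + 1 → A ^ᴹ e ≋[ p ^ k ] A
^ᴹ-≡1 {A} {p} {k} {suc e} A≋I _ e+1≡1 = begin
  A ⊗ A ^ᴹ e ≈⟨ ⊗-congˡ {A = A} (≋-weaken (ℕ∣.n∣m*n p) (^ᴹ-≋I-∣ {k = k} A≋I p^k∣e)) ⟩
  A ⊗ I      ≡⟨ ⊗-identityʳ A ⟩
  A          ∎
  where
  open ≋-Reasoning (p ^ k)
  p^k∣e : p ^ k ∣ e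
  p^k∣e = mod-ℕ⇒∣∸ (s≤s z≤n) (mod-sym e+1≡1)

-- Powers of integers inherit the pigeonhole bound for matrices through scalar matrices.
scalar : ℤ → Mat
scalar x = mat x (+ 0) (+ 0) x

scalar-^ᴹ : ∀ c t → scalar (+ c) ^ᴹ t ≡ scalar (+ (c ^ t))
scalar-^ᴹ c zero    = refl
scalar-^ᴹ c (suc t) = trans (cong (scalar (+ c) ⊗_) (scalar-^ᴹ c t))
  (mat-≡ (trans (left (+ c) (+ (c ^ t))) (sym (ℤₚ.pos-* c (c ^ t)))) (off-diagonal (+ c) (+ (c ^ t)))
         (off-diagonal′ (+ c) (+ (c ^ t))) (trans (right (+ c) (+ (c ^ t))) (sym (ℤₚ.pos-* c (c ^ t)))))
  where
  left : ∀ x y → x ℤ.* y ℤ.+ + 0 ℤ.* + 0 ≡ x ℤ.* y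
  left = solve-∀
  right : ∀ x y → + 0 ℤ.* + 0 ℤ.+ x ℤ.* y ≡ x ℤ.* y
  right = solve-∀
  off-diagonal : ∀ x y → x ℤ.* + 0 ℤ.+ + 0 ℤ.* y ≡ + 0
  off-diagonal = solve-∀
  off-diagonal′ : ∀ x y → + 0 ℤ.* y ℤ.+ x ℤ.* + 0 ≡ + 0
  off-diagonal′ = solve-∀

^ᴹ-scalar : ∀ {N} c {x y} → scalar (+ c) ^ᴹ x ≋[ N ] scalar (+ c) ^ᴹ y → + (c ^ x) ≡[ N ] + (c ^ y)
^ᴹ-scalar c {x} {y} cˣ≋cʸ = ≋₁₁ (subst₂ (λ A B → A ≋[ _ ] B) (scalar-^ᴹ c x) (scalar-^ᴹ c y) cˣ≋cʸ)

^-stable : ∀ {Q} c {x y} → 1 ≤ Q → Q ⁴ ≤ x → DivisibleUpTo (Q ⁴) x → x ≤ y → x ∣ y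
         → + (c ^ x) ≡[ Q ] + (c ^ y)
^-stable {suc Q} c {x} {y} _ Q⁴≤x divisible x≤y x∣y =
  ^ᴹ-scalar c (^ᴹ-stable (scalar (+ c)) Q⁴≤x (ℕₚ.≤-trans Q⁴≤x x≤y) divisible (∣∸⇒mod-ℕ x≤y x∣y∸x))
  where
  x∣y∸x : x ∣ y ∸ x
  x∣y∸x = ℕ∣.∣m+n∣m⇒∣n (subst (x ∣_) (sym (ℕₚ.m+[n∸m]≡n x≤y)) x∣y) ℕ∣.∣-refl

^-≡1 : ∀ {p c k x} → Prime p → ¬ p ∣ c → DivisibleUpTo ((p ^ k) ⁴) x → + (c ^ x) ≡[ p ^ k ] + 1
^-≡1 {p} {c} {k} {x} p-prime p∤c divisible =
  subst (λ N → + (c ^ x) ≡[ N ] + 1) Q+1≡p^k (mod-^-≡1-∣ cˢ≡1 s∣x)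
  where
  c≢0 : c ≢ 0
  c≢0 refl = p∤c (ℕ∣._∣0 p)
  instance
    _ : NonZero p
    _ = >-nonZero (prime≥1 p-prime)
    _ : NonZero c
    _ = ≢-nonZero c≢0
  Q = pred (p ^ k)
  Q+1≡p^k : suc Q ≡ p ^ k
  Q+1≡p^k = ℕₚ.suc-pred (p ^ k) {{ℕₚ.m^n≢0 p k}}
  open Period (period-by-pigeonhole Q (scalar (+ c)))
  cʳ≤cʳ⁺ˢ : c ^ preperiod ≤ c ^ (preperiod + period)
  cʳ≤cʳ⁺ˢ = ℕₚ.^-monoʳ-≤ c (ℕₚ.m≤m+n preperiod period)
  cʳ⁺ˢ∸cʳ : c ^ (preperiod + period) ∸ c ^ preperiod ≡ c ^ preperiod * (c ^ period ∸ 1)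
  cʳ⁺ˢ∸cʳ = begin
    c ^ (preperiod + period) ∸ c ^ preperiod
      ≡⟨ cong₂ _∸_ (ℕₚ.^-distribˡ-+-* c preperiod period) (sym (ℕₚ.*-identityʳ (c ^ preperiod))) ⟩
    c ^ preperiod * c ^ period ∸ c ^ preperiod * 1
      ≡⟨ sym (ℕₚ.*-distribˡ-∸ (c ^ preperiod) (c ^ period) 1) ⟩
    c ^ preperiod * (c ^ period ∸ 1)
      ∎
    where open ≡-Reasoning
  p^k∣cˢ∸1 : p ^ k ∣ c ^ period ∸ 1
  p^k∣cˢ∸1 = prime^-cancelˡ p-prime (prime∤^ p-prime p∤c preperiod) k _
    (subst₂ _∣_ Q+1≡p^k cʳ⁺ˢ∸cʳ (mod-ℕ⇒∣∸ cʳ≤cʳ⁺ˢ (^ᴹ-scalar c periodic)))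
  cˢ≡1 : + (c ^ period) ≡[ suc Q ] + 1
  cˢ≡1 = mod-sym (∣∸⇒mod-ℕ (ℕₚ.m^n>0 c period) (subst (_∣ c ^ period ∸ 1) (sym Q+1≡p^k) p^k∣cˢ∸1))
  s∣x : period ∣ x
  s∣x = divisible period≥1 (subst (λ N → period ≤ N ⁴) Q+1≡p^k (ℕₚ.≤-trans (ℕₚ.m≤n+m period preperiod) bounded))

-- Exponents converging in Ẑ

F : ℕ → ℕ
F n = suc n ⁴ !

X : ℕ → ℕ
X n = F n ⁴ !

F≥1 : ∀ n → 1 ≤ F n
F≥1 n = ℕₚ.1≤n! (suc n ⁴)

n⁴≤F : ∀ n → suc n ⁴ ≤ F n
n⁴≤F n = n≤n! (suc n ⁴)

F-∣ : ∀ {m n} → m ≤ n → F m ∣ F n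
F-∣ m≤n = ℕ∣.m≤n⇒m!∣n! (⁴-mono-≤ (s≤s m≤n))

F⁴≤X : ∀ n → F n ⁴ ≤ X n
F⁴≤X n = n≤n! (F n ⁴)

F≤X : ∀ n → F n ≤ X n
F≤X n = ℕₚ.≤-trans (n≤n⁴ (F≥1 n)) (F⁴≤X n)

X-mono-≤ : ∀ {m n} → m ≤ n → X m ≤ X n
X-mono-≤ m≤n = !-mono-≤ (⁴-mono-≤ (!-mono-≤ (⁴-mono-≤ (s≤s m≤n))))

X-∣ : ∀ {m n} → m ≤ n → X m ∣ X n
X-∣ m≤n = ℕ∣.m≤n⇒m!∣n! (⁴-mono-≤ (!-mono-≤ (⁴-mono-≤ (s≤s m≤n))))

-- E c n converges in Ẑ to the idempotent that is 1 at primes not dividing c and 0 at the others;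
-- the summand F n, which tends to 0, keeps it above every preperiod at level n.
E : ℕ → ℕ → ℕ
E c n = c ^ X n + F n

n⁴≤E : ∀ c n → suc n ⁴ ≤ E c n
n⁴≤E c n = ℕₚ.≤-trans (n⁴≤F n) (ℕₚ.m≤n+m (F n) (c ^ X n))

E≥1 : ∀ c n → 1 ≤ E c n
E≥1 c n = ℕₚ.≤-trans (s≤s z≤n) (ℕₚ.≤-trans (n≤n⁴ {suc n} (s≤s z≤n)) (n⁴≤E c n))

E-coherent : ∀ c {m n} → m ≤ n → + E c n ≡[ F m ] + E c m
E-coherent c {m} {n} m≤n =
  subst₂ (λ x y → x ≡[ F m ] y) (sym (ℤₚ.pos-+ (c ^ X n) (F n))) (sym (ℤₚ.pos-+ (c ^ X m) (F m)))
  (mod-+-cong (mod-sym (^-stable c (F≥1 m) (F⁴≤X m) (!-divisibleUpTo (F m ⁴)) (X-mono-≤ m≤n) (X-∣ m≤n)))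
              (mod-trans (∣⇒≡0 (F-∣ m≤n)) (mod-sym (∣⇒≡0 ℕ∣.∣-refl))))

≤suc⇒∣F : ∀ {s n} → 1 ≤ s → s ≤ suc n → s ∣ F n
≤suc⇒∣F {n = n} 1≤s s≤n+1 = !-divisibleUpTo (suc n ⁴) 1≤s (ℕₚ.≤-trans s≤n+1 (n≤n⁴ (s≤s z≤n)))

E-≡1 : ∀ {p c k n} → Prime p → ¬ p ∣ c → p ^ k ≤ suc n → + E c n ≡[ p ^ k ] + 1
E-≡1 {p} {c} {k} {n} p-prime p∤c p^k≤n+1 = subst (λ x → x ≡[ p ^ k ] + 1) (sym (ℤₚ.pos-+ (c ^ X n) (F n)))
  (mod-+-cong (^-≡1 {k = k} p-prime p∤c divisible) (∣⇒≡0 (≤suc⇒∣F p^k≥1 p^k≤n+1)))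
  where
  p^k≥1 : 1 ≤ p ^ k
  p^k≥1 = ℕₚ.m^n>0 p {{>-nonZero (prime≥1 p-prime)}} k
  divisible : DivisibleUpTo ((p ^ k) ⁴) (X n)
  divisible 1≤s s≤ = !-divisibleUpTo (F n ⁴) 1≤s
    (ℕₚ.≤-trans s≤ (ℕₚ.≤-trans (⁴-mono-≤ p^k≤n+1) (ℕₚ.≤-trans (n⁴≤F n) (n≤n⁴ (F≥1 n)))))

E-∣ : ∀ {p c k n} → 2 ≤ p → p ∣ c → p ^ k ≤ suc n → p ^ k ∣ E c n
E-∣ {p} {c} {k} {n} p≥2 p∣c p^k≤n+1 =
  ℕ∣.∣m∣n⇒∣m+n (ℕ∣.∣-trans (^-∣-^ k p∣c) (^-monoʳ-∣ c k≤X)) (≤suc⇒∣F p^k≥1 p^k≤n+1)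
  where
  p^k≥1 : 1 ≤ p ^ k
  p^k≥1 = ℕₚ.≤-trans (s≤s z≤n) (n<p^n p≥2 k)
  k≤X : k ≤ X n
  k≤X = ℕₚ.≤-trans (ℕₚ.<⇒≤ (n<p^n p≥2 k))
          (ℕₚ.≤-trans p^k≤n+1 (ℕₚ.≤-trans (n≤n⁴ (s≤s z≤n)) (ℕₚ.≤-trans (n⁴≤F n) (F≤X n))))

-- Closed subgroups of GL₂(Ẑ)

red : ℕ → GL2Ẑ → Mat
red n g = mat (res (a g) n) (res (b g) n) (res (c g) n) (res (d g) n)

RedEq⇒≋ : ∀ {N g h} → RedEq N g h → red (pred N) g ≋[ N ] red (pred N) h
RedEq⇒≋ (p , q , r , s) = entrywise (mkMod p) (mkMod q) (mkMod r) (mkMod s)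

≋⇒RedEq : ∀ {N g h} → red (pred N) g ≋[ N ] red (pred N) h → RedEq N g h
≋⇒RedEq (entrywise p q r s) = congr p , congr q , congr r , congr s

red-compat : ∀ g {m n} → suc m ∣ suc n → red n g ≋[ suc m ] red m g
red-compat g {m} {n} m+1∣n+1 = entrywise (mkMod (compat (a g) m n m+1∣n+1)) (mkMod (compat (b g) m n m+1∣n+1))
                                         (mkMod (compat (c g) m n m+1∣n+1)) (mkMod (compat (d g) m n m+1∣n+1))

red-≋ : ∀ {d N g h} n → 1 ≤ d → 1 ≤ N → d ∣ N → d ∣ suc n → RedEq N g h → red n g ≋[ d ] red n h
red-≋ {suc d} {suc N} {g} {h} n _ _ d∣N d∣n+1 g≡h = begin
  red n g ≈⟨ red-compat g d∣n+1 ⟩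
  red d g ≈⟨ ≋-sym (red-compat g d∣N) ⟩
  red N g ≈⟨ ≋-weaken d∣N (RedEq⇒≋ {suc N} {g} {h} g≡h) ⟩
  red N h ≈⟨ red-compat h d∣N ⟩
  red d h ≈⟨ ≋-sym (red-compat h d∣n+1) ⟩
  red n h ∎
  where open ≋-Reasoning (suc d)

RedEq-∣ : ∀ {d N g h} → 1 ≤ d → 1 ≤ N → d ∣ N → RedEq N g h → RedEq d g h
RedEq-∣ {suc d} {N} {g} {h} 1≤d 1≤N d∣N g≡h =
  ≋⇒RedEq {suc d} {g} {h} (red-≋ {N = N} {g} {h} d 1≤d 1≤N d∣N ℕ∣.∣-refl g≡h)

RedEq-1 : ∀ {g h} → RedEq 1 g h
RedEq-1 {g} {h} = ≋⇒RedEq {1} {g} {h} ≋-1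

module Subgroup {G : GL2Ẑ → Set} (G-closed : IsClosedSubgroup G) where
  open IsClosedSubgroup G-closed

  Element : Set
  Element = Σ GL2Ẑ G

  ⟦_⟧_ : Element → ℕ → Mat
  ⟦ x ⟧ n = red n (proj₁ x)

  one : Element
  one = proj₁ hasId , proj₁ (proj₂ hasId)

  one-red : ∀ n → ⟦ one ⟧ n ≋[ suc n ] I
  one-red n with p , q , r , s ← proj₂ (proj₂ hasId) n = entrywise (mkMod p) (mkMod q) (mkMod r) (mkMod s)

  infixl 7 _∙_
  _∙_ : Element → Element → Element
  (g , g∈G) ∙ (h , h∈G) = proj₁ (mulCl g h g∈G h∈G) , proj₁ (proj₂ (mulCl g h g∈G h∈G))

  ∙-red : ∀ n x y → ⟦ x ∙ y ⟧ n ≋[ suc n ] ⟦ x ⟧ n ⊗ ⟦ y ⟧ n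
  ∙-red n (g , g∈G) (h , h∈G) with p , q , r , s ← proj₂ (proj₂ (mulCl g h g∈G h∈G)) n =
    entrywise (mkMod p) (mkMod q) (mkMod r) (mkMod s)

  infix 8 _⁻¹
  _⁻¹ : Element → Element
  (g , g∈G) ⁻¹ = proj₁ (invCl g g∈G) , proj₁ (proj₂ (invCl g g∈G))

  ⁻¹-red : ∀ n x → ⟦ x ⁻¹ ⟧ n ⊗ ⟦ x ⟧ n ≋[ suc n ] I
  ⁻¹-red n (g , g∈G) with p , q , r , s ← proj₂ (proj₂ (invCl g g∈G)) n =
    entrywise (mkMod p) (mkMod q) (mkMod r) (mkMod s)

  infixr 8 _^ᴳ_
  _^ᴳ_ : Element → ℕ → Element
  x ^ᴳ zero  = one
  x ^ᴳ suc e = x ∙ x ^ᴳ e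

  ^ᴳ-red : ∀ n x e → ⟦ x ^ᴳ e ⟧ n ≋[ suc n ] ⟦ x ⟧ n ^ᴹ e
  ^ᴳ-red n x zero    = one-red n
  ^ᴳ-red n x (suc e) = ≋-trans (∙-red n x (x ^ᴳ e)) (⊗-congˡ {A = ⟦ x ⟧ n} (^ᴳ-red n x e))

  ∏ᴳ : ∀ {q} → (Fin q → Element) → Element
  ∏ᴳ {zero}  x = one
  ∏ᴳ {suc q} x = x zero ∙ ∏ᴳ (x ∘ suc)

  ∏ᴳ-red : ∀ n {q} (x : Fin q → Element) → ⟦ ∏ᴳ x ⟧ n ≋[ suc n ] ∏ᴹ (λ i → ⟦ x i ⟧ n)
  ∏ᴳ-red n {zero}  x = one-red n
  ∏ᴳ-red n {suc q} x =
    ≋-trans (∙-red n (x zero) (∏ᴳ (x ∘ suc))) (⊗-congˡ {A = ⟦ x zero ⟧ n} (∏ᴳ-red n (x ∘ suc)))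

  Coherent : (ℕ → Element) → Set
  Coherent f = ∀ {m n} → suc m ∣ suc n → ⟦ f n ⟧ m ≋[ suc m ] ⟦ f m ⟧ m

  limit : (f : ℕ → Element) → Coherent f → Σ Element λ z → ∀ n → ⟦ z ⟧ n ≡ ⟦ f n ⟧ n
  limit f coherent = (z , closed z approximations) , λ n → refl
    where
    diagonal : (entry : GL2Ẑ → Ẑ)
             → (∀ {m n} → suc m ∣ suc n → res (entry (proj₁ (f n))) m ≡[ suc m ] res (entry (proj₁ (f m))) m) → Ẑ
    diagonal entry entry-coherent = record
      { res    = λ n → res (entry (proj₁ (f n))) n
      ; compat = λ m n m+1∣n+1 → congr (mod-trans {x = res (entry (proj₁ (f n))) n}
                                          (mkMod (compat (entry (proj₁ (f n))) m n m+1∣n+1)) (entry-coherent m+1∣n+1))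
      }
    z : GL2Ẑ
    z = record
      { a = diagonal a (≋₁₁ ∘ coherent) ; b = diagonal b (≋₁₂ ∘ coherent)
      ; c = diagonal c (≋₂₁ ∘ coherent) ; d = diagonal d (≋₂₂ ∘ coherent)
      ; detUnit = λ n → detUnit (proj₁ (f n)) n
      }
    approximations : ∀ n → ∃ λ h → G h × RedEq (suc n) h z
    approximations n = proj₁ (f n) , proj₂ (f n) , ≋⇒RedEq {suc n} {proj₁ (f n)} {z} ≋-refl

module Proposition
    (q : ℕ) (ℓ : Fin q → ℕ) (t : Fin q → ℕ)
    (primes : ∀ i → Prime (ℓ i)) (ℓ-injective : Injective _≡_ _≡_ ℓ) (t≥1 : ∀ i → 1 ≤ t i)
    {G : GL2Ẑ → Set} (G-closed : IsClosedSubgroup G) where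

  open Subgroup G-closed

  m M : ℕ
  m = prodFin ℓ
  M = prodFin (λ i → ℓ i ^ t i)

  m∖ : Fin q → ℕ
  m∖ i = prodExcept i ℓ

  ℓ^k≥1 : ∀ i k → 1 ≤ ℓ i ^ k
  ℓ^k≥1 i k = ℕₚ.m^n>0 (ℓ i) {{>-nonZero (prime≥1 (primes i))}} k

  M≥1 : 1 ≤ M
  M≥1 = prodFin≥1 λ i → ℓ^k≥1 i (t i)

  m^k≥1 : ∀ k → 1 ≤ m ^ k
  m^k≥1 k = ℕₚ.m^n>0 m {{>-nonZero (prodFin≥1 (prime≥1 ∘ primes))}} k

  m∖ℓ^k≥1 : ∀ i k → 1 ≤ m∖ i * ℓ i ^ k
  m∖ℓ^k≥1 i k = ℕₚ.*-mono-≤ (prodExcept≥1 i (prime≥1 ∘ primes)) (ℓ^k≥1 i k)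

  ℓ∣ℓ^t : ∀ i → ℓ i ∣ ℓ i ^ t i
  ℓ∣ℓ^t i = subst (_∣ ℓ i ^ t i) (ℕₚ.*-identityʳ (ℓ i)) (^-monoʳ-∣ (ℓ i) (t≥1 i))

  ℓ∣M : ∀ i → ℓ i ∣ M
  ℓ∣M i = ℕ∣.∣-trans (ℓ∣ℓ^t i) (∣-prodFin (λ j → ℓ j ^ t j) i)

  ℓ∣m∖ℓ : ∀ i j → ℓ i ∣ m∖ j * ℓ j ^ 1
  ℓ∣m∖ℓ i j = subst (λ x → ℓ i ∣ m∖ j * x) (sym (ℕₚ.*-identityʳ (ℓ j)))
                    (subst (ℓ i ∣_) (sym (prodExcept-* j ℓ)) (∣-prodFin ℓ i))

  M∣m^M : M ∣ m ^ M
  M∣m^M = subst (M ∣_) (sym (prodFin-^ ℓ M)) (prodFin-∣ λ i → ^-monoʳ-∣ (ℓ i) (tᵢ≤M i))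
    where
    tᵢ≤M : ∀ i → t i ≤ M
    tᵢ≤M i = ℕₚ.≤-trans (ℕₚ.<⇒≤ (n<p^n (prime≥2 (primes i)) (t i)))
                        (ℕ∣.∣⇒≤ {{>-nonZero M≥1}} (∣-prodFin (λ j → ℓ j ^ t j) i))

  adic⇒mod : ∀ g → InImageAdic G 1 m g → InImageMod G M g
  adic⇒mod g (h , h∈G , h≡g) =
    h , h∈G , RedEq-∣ {g = h} {g} M≥1 (m^k≥1 M) M∣m^M (subst (λ N → RedEq N h g) (ℕₚ.*-identityˡ (m ^ M)) (h≡g M))

  module Lift
      (hyp : ∀ i g → InImageAdic G (m∖ i) (ℓ i) g ⇔ InImageMod G (m∖ i * ℓ i ^ t i) g)
      (g : GL2Ẑ) (h : Element) (h≡g : RedEq M (proj₁ h) g) where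

    y-adic : ∀ i → InImageAdic G (m∖ i) (ℓ i) g
    y-adic i = Equivalence.from (hyp i g)
      (proj₁ h , proj₂ h , RedEq-∣ {g = proj₁ h} {g} (m∖ℓ^k≥1 i (t i)) M≥1 (prodExcept-*-∣ i ℓ∣ℓ^t) h≡g)

    y : Fin q → Element
    y i = proj₁ (y-adic i) , proj₁ (proj₂ (y-adic i))

    y≡g : ∀ i k → RedEq (m∖ i * ℓ i ^ k) (proj₁ (y i)) g
    y≡g i = proj₂ (proj₂ (y-adic i))

    w : Fin q → Element
    w i = h ⁻¹ ∙ y i

    -- Closed subgroups only come with left inverses, so h is replaced by u, for which u h⁻¹ ≡ I.
    u : Element
    u = (h ⁻¹) ⁻¹

    f : ℕ → Element
    f n = u ∙ ∏ᴳ (λ i → w i ^ᴳ E (m∖ i) n)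

    f-red : ∀ l n → ⟦ f n ⟧ l ≋[ suc l ] ⟦ u ⟧ l ⊗ ∏ᴹ (λ i → ⟦ w i ⟧ l ^ᴹ E (m∖ i) n)
    f-red l n = ≋-trans (∙-red l u _) (⊗-congˡ {A = ⟦ u ⟧ l}
      (≋-trans (∏ᴳ-red l (λ i → w i ^ᴳ E (m∖ i) n)) (∏ᴹ-cong λ i → ^ᴳ-red l (w i) (E (m∖ i) n))))

    f-coherent : Coherent f
    f-coherent {l} {n} l+1∣n+1 = begin
      ⟦ f n ⟧ l                                        ≈⟨ f-red l n ⟩
      ⟦ u ⟧ l ⊗ ∏ᴹ (λ i → ⟦ w i ⟧ l ^ᴹ E (m∖ i) n)   ≈⟨ ⊗-congˡ {A = ⟦ u ⟧ l} (∏ᴹ-cong λ i → stable i) ⟩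
      ⟦ u ⟧ l ⊗ ∏ᴹ (λ i → ⟦ w i ⟧ l ^ᴹ E (m∖ i) l)   ≈⟨ ≋-sym (f-red l l) ⟩
      ⟦ f l ⟧ l                                        ∎
      where
      open ≋-Reasoning (suc l)
      l≤n : l ≤ n
      l≤n = ℕₚ.≤-pred (ℕ∣.∣⇒≤ l+1∣n+1)
      stable : ∀ i → ⟦ w i ⟧ l ^ᴹ E (m∖ i) n ≋[ suc l ] ⟦ w i ⟧ l ^ᴹ E (m∖ i) l
      stable i = ^ᴹ-stable (⟦ w i ⟧ l) (ℕₚ.≤-trans (⁴-mono-≤ (s≤s l≤n)) (n⁴≤E (m∖ i) n)) (n⁴≤E (m∖ i) l)
                           (!-divisibleUpTo (suc l ⁴)) (E-coherent (m∖ i) l≤n)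

    module AtLevel (k n : ℕ) (n+1≡m^k : suc n ≡ m ^ suc k) where

      ℓ^k∣n+1 : ∀ i → ℓ i ^ suc k ∣ suc n
      ℓ^k∣n+1 i = subst (ℓ i ^ suc k ∣_) (sym n+1≡m^k) (^-∣-^ (suc k) (∣-prodFin ℓ i))

      ℓ∣n+1 : ∀ i → ℓ i ∣ suc n
      ℓ∣n+1 i = ℕ∣.∣-trans (ℕ∣.m∣m*n (ℓ i ^ k)) (ℓ^k∣n+1 i)

      w≋I : ∀ i j → ⟦ w j ⟧ n ≋[ ℓ i ] I
      w≋I i j = begin
        ⟦ h ⁻¹ ∙ y j ⟧ n      ≈⟨ ≋-weaken (ℓ∣n+1 i) (∙-red n (h ⁻¹) (y j)) ⟩
        ⟦ h ⁻¹ ⟧ n ⊗ ⟦ y j ⟧ n ≈⟨ ⊗-congˡ {A = ⟦ h ⁻¹ ⟧ n} yⱼ≡g ⟩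
        ⟦ h ⁻¹ ⟧ n ⊗ red n g  ≈⟨ ⊗-congˡ {A = ⟦ h ⁻¹ ⟧ n} (≋-sym h≡g-mod-ℓ) ⟩
        ⟦ h ⁻¹ ⟧ n ⊗ ⟦ h ⟧ n   ≈⟨ ≋-weaken (ℓ∣n+1 i) (⁻¹-red n h) ⟩
        I                     ∎
        where
        open ≋-Reasoning (ℓ i)
        ℓ≥1 = prime≥1 (primes i)
        yⱼ≡g : ⟦ y j ⟧ n ≋[ ℓ i ] red n g
        yⱼ≡g = red-≋ {g = proj₁ (y j)} {g} n ℓ≥1 (m∖ℓ^k≥1 j 1) (ℓ∣m∖ℓ i j) (ℓ∣n+1 i) (y≡g j 1)
        h≡g-mod-ℓ : ⟦ h ⟧ n ≋[ ℓ i ] red n g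
        h≡g-mod-ℓ = red-≋ {g = proj₁ h} {g} n ℓ≥1 M≥1 (ℓ∣M i) (ℓ∣n+1 i) h≡g

      others : ∀ i j → j ≢ i → ⟦ w j ⟧ n ^ᴹ E (m∖ j) n ≋[ ℓ i ^ suc k ] I
      others i j j≢i = ≋-weaken (ℕ∣.n∣m*n (ℓ i)) (^ᴹ-≋I-∣ {k = suc k} (w≋I i j)
        (E-∣ {k = suc k} (prime≥2 (primes i)) (∣-prodExcept ℓ (j≢i ∘ sym)) (ℕ∣.∣⇒≤ (ℓ^k∣n+1 i))))

      own : ∀ i → ⟦ w i ⟧ n ^ᴹ E (m∖ i) n ≋[ ℓ i ^ suc k ] ⟦ w i ⟧ n
      own i = ^ᴹ-≡1 {k = suc k} (w≋I i i) (E≥1 (m∖ i) n)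
        (E-≡1 {k = suc k} (primes i) (prime∤prodExcept primes ℓ-injective i) (ℕ∣.∣⇒≤ (ℓ^k∣n+1 i)))

      u∙w : ∀ i → ⟦ u ⟧ n ⊗ ⟦ w i ⟧ n ≋[ suc n ] ⟦ y i ⟧ n
      u∙w i = begin
        ⟦ u ⟧ n ⊗ ⟦ h ⁻¹ ∙ y i ⟧ n        ≈⟨ ⊗-congˡ {A = ⟦ u ⟧ n} (∙-red n (h ⁻¹) (y i)) ⟩
        ⟦ u ⟧ n ⊗ (⟦ h ⁻¹ ⟧ n ⊗ ⟦ y i ⟧ n) ≡⟨ sym (⊗-assoc (⟦ u ⟧ n) _ _) ⟩
        ⟦ u ⟧ n ⊗ ⟦ h ⁻¹ ⟧ n ⊗ ⟦ y i ⟧ n   ≈⟨ ⊗-cong (⁻¹-red n (h ⁻¹)) (≋-refl {A = ⟦ y i ⟧ n}) ⟩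
        I ⊗ ⟦ y i ⟧ n                     ≡⟨ ⊗-identityˡ (⟦ y i ⟧ n) ⟩
        ⟦ y i ⟧ n                         ∎
        where open ≋-Reasoning (suc n)

      f≡g-mod-ℓ^k : ∀ i → ⟦ f n ⟧ n ≋[ ℓ i ^ suc k ] red n g
      f≡g-mod-ℓ^k i = begin
        ⟦ f n ⟧ n                                      ≈⟨ ≋-weaken (ℓ^k∣n+1 i) (f-red n n) ⟩
        ⟦ u ⟧ n ⊗ ∏ᴹ (λ j → ⟦ w j ⟧ n ^ᴹ E (m∖ j) n)  ≈⟨ ⊗-congˡ {A = ⟦ u ⟧ n} (∏ᴹ-single _ i (others i)) ⟩
        ⟦ u ⟧ n ⊗ ⟦ w i ⟧ n ^ᴹ E (m∖ i) n             ≈⟨ ⊗-congˡ {A = ⟦ u ⟧ n} (own i) ⟩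
        ⟦ u ⟧ n ⊗ ⟦ w i ⟧ n                           ≈⟨ ≋-weaken (ℓ^k∣n+1 i) (u∙w i) ⟩
        ⟦ y i ⟧ n                                     ≈⟨ yᵢ≡g ⟩
        red n g                                       ∎
        where
        open ≋-Reasoning (ℓ i ^ suc k)
        yᵢ≡g : ⟦ y i ⟧ n ≋[ ℓ i ^ suc k ] red n g
        yᵢ≡g = red-≋ {g = proj₁ (y i)} {g} n (ℓ^k≥1 i (suc k)) (m∖ℓ^k≥1 i (suc k)) (ℕ∣.n∣m*n (m∖ i))
                     (ℓ^k∣n+1 i) (y≡g i (suc k))

      f≡g : ⟦ f n ⟧ n ≋[ suc n ] red n g
      f≡g = subst (λ N → ⟦ f n ⟧ n ≋[ N ] red n g) (sym n+1≡m^k) (≋-crt primes ℓ-injective (suc k) f≡g-mod-ℓ^k)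

    z : Element
    z = proj₁ (limit f f-coherent)

    z≡g : ∀ k → RedEq (m ^ k) (proj₁ z) g
    z≡g zero    = RedEq-1 {proj₁ z} {g}
    z≡g (suc k) = subst (λ N → RedEq N (proj₁ z) g) n+1≡m^k
      (≋⇒RedEq {suc n} {proj₁ z} {g} (≋-trans (≋-reflexive (proj₂ (limit f f-coherent) n)) (AtLevel.f≡g k n n+1≡m^k)))
      where
      n = pred (m ^ suc k)
      n+1≡m^k : suc n ≡ m ^ suc k
      n+1≡m^k = ℕₚ.suc-pred (m ^ suc k) {{>-nonZero (m^k≥1 (suc k))}}

    mod⇒adic : InImageAdic G 1 m g
    mod⇒adic = proj₁ z , proj₂ z , λ k → subst (λ N → RedEq N (proj₁ z) g) (sym (ℕₚ.*-identityˡ (m ^ k))) (z≡g k)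

proposition3p7 : (q : ℕ) (ℓ : Fin q → ℕ) (t : Fin q → ℕ)
    → (∀ i → Prime (ℓ i)) → Injective _≡_ _≡_ ℓ → (∀ i → 1 ≤ t i)
    → (G : GL2Ẑ → Set) → IsClosedSubgroup G
    → (∀ i (g : GL2Ẑ) → InImageAdic G (prodExcept i ℓ) (ℓ i) g
         ⇔ InImageMod G (prodExcept i ℓ * ℓ i ^ t i) g)
    → ∀ (g : GL2Ẑ) → InImageAdic G 1 (prodFin ℓ) g
         ⇔ InImageMod G (prodFin (λ i → ℓ i ^ t i)) g
proposition3p7 q ℓ t primes ℓ-injective t≥1 G G-closed hyp g =
  mk⇔ (adic⇒mod g) λ (h , h∈G , h≡g) → Lift.mod⇒adic hyp g (h , h∈G) h≡g
  where open Proposition q ℓ t primes ℓ-injective t≥1 G-closed
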